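{- Let $d,n',k,n\ge1$, $i\ge0$, $\alpha=\omega^d\cdot n'$, and write $\alpha\cdot n=\omega^d\cdot(n'n)$. If $(X_m: m<2^in-2^i+1)$ is a stack of $(\alpha,k,i)$-persistent sets, then $\bigcup_m X_m$ is $(\alpha\cdot n,k,i)$-persistent.
   Context: Strings are finite binary sequences; $\preceq$ is initial segment, $\tau$ extends $\sigma$ if $\sigma\preceq\tau$, incompatible means neither is an initial segment of the other; $2^i$ denotes the set of strings of length $i$ (and also the number $2^i$); a tree is a set of strings closed under initial segments; a leaf is a node with no proper extension in the tree. For finite $X=\{x_0<\dots<x_n\}$, a finite tree $T$ is $X$-quasistrong if $T\cap 2^{x_i}\ne\emptyset$ for all $i\le n$ and for each $i<n$ every $\sigma\in T\cap 2^{x_i}$ has exactly two incompatible extensions in $T\cap 2^{x_{i+1}}$. A stack is a sequence $(X_m:m<n)$ of nonempty finite sets with $\max X_m<\min X_{m+1}$. Largeness: a nonempty finite $X$ is $\omega$-large if $|X|>\min X$; $\omega^d\cdot n$-large if it is the union of a stack of $n$ many $\omega^d$-large sets; $\omega^{d+1}$-large if $X=\{\min X\}\cup X_1$ with $\min X_1>\min X$ and $X_1$ $\omega^d\cdot\min X$-large. Persistence: for $\alpha=\omega^d\cdot n'$, $X$ is $(\alpha,k,0)$-persistent if it is $\alpha$-large; for $i\ge1$, $X$ is $(\alpha,k,i)$-persistent if $X$ contains an $(\alpha,k,i-1)$-persistent subset $Y$ such that for every $X$-quasistrong tree $T$ and every $C:T\cap 2^{\max X}\to k$ there exist $c<k$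 and a $Y$-quasistrong finite tree $S\subseteq T$ every leaf of which has an extension in $C^{ -1}(c)$. -}

module Defs where

open import Data.Nat using (ℕ; zero; suc; _<_; _⊔_)
open import Data.Bool using (Bool)
open import Data.Fin using (Fin)
open import Data.List using (List; []; _∷_; length; concat; foldr)
open import Data.List.Membership.Propositional using (_∈_)
open import Data.List.Relation.Unary.All using (All)
open import Data.Product using (Σ; ∃; _×_; _,_)
open import Data.Sum using (_⊎_)
open import Data.Unit using (⊤)
open import Data.Empty using (⊥)
open import Relation.Nullary using (¬_)
open import Relation.Binary.PropositionalEquality using (_≡_)

-- Finite sets of naturals are represented by strictly increasing lists
-- (x₀ < x₁ < … < xₙ).  The union of a stack is then its concatenation.

StrictInc : List ℕ → Set
StrictInc []           = ⊤
StrictInc (x ∷ [])     = ⊤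
StrictInc (x ∷ y ∷ xs) = x < y × StrictInc (y ∷ xs)

NonEmpty : List ℕ → Set
NonEmpty []      = ⊥
NonEmpty (_ ∷ _) = ⊤

minL : List ℕ → ℕ
minL []      = 0
minL (x ∷ _) = x

maxL : List ℕ → ℕ
maxL xs = foldr _⊔_ 0 xs

_⊆ₗ_ : List ℕ → List ℕ → Set
Y ⊆ₗ X = ∀ {y} → y ∈ Y → y ∈ X

Stack : List (List ℕ) → Set
Stack []             = ⊤
Stack (X ∷ [])       = StrictInc X × NonEmpty X
Stack (X ∷ Y ∷ Xs)   = (StrictInc X × NonEmpty X) × maxL X < minL Y × Stack (Y ∷ Xs)

-- Largeness.  Large d X  :  X is ω^d-large   (d ≥ 1; d = 0 is not used)
--             LargeN d n X : X is ω^d·n-large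

mutual
  Large : ℕ → List ℕ → Set
  Large zero X = ⊥
  Large (suc zero) X = StrictInc X × NonEmpty X × minL X < length X
  Large (suc (suc d)) [] = ⊥
  Large (suc (suc d)) (x ∷ X₁) =
    NonEmpty X₁ × x < minL X₁ × LargeN (suc d) x X₁

  LargeN : ℕ → ℕ → List ℕ → Set
  LargeN d n X = Σ (List (List ℕ)) λ Xs →
    length Xs ≡ n × Stack Xs × concat Xs ≡ X × All (Large d) Xs

Str : Set
Str = List Bool

data _≼_ : Str → Str → Set where
  []≼ : ∀ {τ} → [] ≼ τ
  ∷≼  : ∀ {b σ τ} → σ ≼ τ → (b ∷ σ) ≼ (b ∷ τ)

Incompatible : Str → Str → Set
Incompatible σ τ = ¬ (σ ≼ τ) × ¬ (τ ≼ σ)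

IsTree : List Str → Set
IsTree T = ∀ {σ τ} → σ ∈ T → τ ≼ σ → τ ∈ T

TwoExt : List Str → Str → ℕ → Set
TwoExt T σ y = Σ Str λ τ₁ → Σ Str λ τ₂ →
  (τ₁ ∈ T × length τ₁ ≡ y × σ ≼ τ₁) ×
  (τ₂ ∈ T × length τ₂ ≡ y × σ ≼ τ₂) ×
  Incompatible τ₁ τ₂ ×
  (∀ τ → τ ∈ T → length τ ≡ y → σ ≼ τ → τ ≡ τ₁ ⊎ τ ≡ τ₂)

LevelNonEmpty : List Str → ℕ → Set
LevelNonEmpty T x = Σ Str λ σ → σ ∈ T × length σ ≡ x

QuasiStrong : List ℕ → List Str → Set
QuasiStrong [] T = ⊥
QuasiStrong (x ∷ []) T = LevelNonEmpty T x
QuasiStrong (x ∷ y ∷ X) T =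
  LevelNonEmpty T x ×
  (∀ σ → σ ∈ T → length σ ≡ x → TwoExt T σ y) ×
  QuasiStrong (y ∷ X) T

IsLeaf : List Str → Str → Set
IsLeaf S σ = σ ∈ S × (∀ τ → τ ∈ S → σ ≼ τ → τ ≡ σ)

-- Persistence: Persistent d n' k i X  :  X is (ω^d·n', k, i)-persistent.
-- A colouring C : T ∩ 2^{max X} → k is given as a total function on strings;
-- only its values on T ∩ 2^{max X} are used.

Persistent : ℕ → ℕ → ℕ → ℕ → List ℕ → Set
Persistent d n' k zero X = LargeN d n' X
Persistent d n' k (suc i) X =
  StrictInc X ×
  Σ (List ℕ) λ Y → Y ⊆ₗ X × Persistent d n' k i Y ×
    (∀ (T : List Str) → IsTree T → QuasiStrong X T →
     ∀ (C : Str → Fin k) →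
     Σ (Fin k) λ c → Σ (List Str) λ S →
       IsTree S × (∀ {σ} → σ ∈ S → σ ∈ T) × QuasiStrong Y S ×
       (∀ σ → IsLeaf S σ →
          Σ Str λ τ → τ ∈ T × length τ ≡ maxL X × σ ≼ τ × C τ ≡ c))

-- For i = 0 the n stacks of n' many ω^d-large sets concatenate to one
-- stack of n'·n such sets.  For i + 1 write the 2M + 1 sets as X₀ < X₁ < … < X_{2M}, with
-- witnesses Yⱼ ⊆ Xⱼ.  The even witnesses Y₀, Y₂, …, Y_{2M} form a stack of M + 1 sets that are
-- (α,k,i)-persistent, so by induction their union Z is (α·n,k,i)-persistent; it remains to
-- show that Z witnesses the colouring clause for ⋃ Xⱼ.  Given a colouring of a quasistrong tree
-- on ⋃ Xⱼ, colour backwards: a node on level max X_{2j+1} gets the colour of a solution for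
-- (X_{2j+2}, Y_{2j+2}) above it, and a node on level max X_{2j} the colour of a solution for
-- (X_{2j+1}, Y_{2j+1}) under that colouring.  The odd witnesses have two points, so every top
-- node of the Y_{2j}-part acquires two incompatible extensions carrying solutions of one and
-- the same colour, which is exactly the splitting a Z-quasistrong tree needs between max Y_{2j}
-- and min Y_{2j+2}.  For the grafting to work, every solution is kept rooted in the cone of a
-- single node.

module Submission where

open import Defs
open import Data.Bool using (Bool; true; false)
import Data.Bool.Properties as Bool
open import Data.Fin using (Fin)
open import Data.Nat using (ℕ; zero; suc; _≤_; _<_; _+_; _*_; _∸_; _^_; _⊔_; z≤n; s≤s; _≟_)
open import Data.Nat.Properties
open import Data.List using (List; []; _∷_; length; concat; _++_; filter; concatMap)
open import Data.List.Properties using (≡-dec; ++-identityʳ; length-++; concat-++)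
open import Data.List.Extrema.Nat using (argmax; argmax-all; v≤f[argmax]⁺)
open import Data.List.Membership.Propositional using (_∈_; find; lose)
open import Data.List.Membership.Propositional.Properties
  using (∈-filter⁺; ∈-filter⁻; ∈-++⁺ˡ; ∈-++⁺ʳ; ∈-++⁻; ∈-concatMap⁺; ∈-concatMap⁻)
open import Data.List.Membership.DecPropositional (≡-dec Bool._≟_) using (_∈?_)
open import Data.List.Relation.Unary.Any using (Any; here; there; any?)
open import Data.List.Relation.Unary.All using (All; []; _∷_; tabulate)
import Data.List.Relation.Unary.All.Properties as All
open import Data.Product using (Σ; _×_; _,_; proj₁; proj₂)
open import Data.Sum using (_⊎_; inj₁; inj₂; [_,_]; [_,_]′)
open import Data.Unit using (tt)
open import Data.Empty using (⊥; ⊥-elim)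
open import Function using (_∘′_)
open import Relation.Nullary using (Dec; yes; no)
open import Relation.Nullary.Decidable using (_×-dec_; _⊎-dec_; map′)
open import Relation.Unary using (Decidable)
open import Relation.Binary.PropositionalEquality
  using (_≡_; refl; sym; trans; cong; cong₂; subst; subst₂; module ≡-Reasoning)

private
  variable
    a b x y M : ℕ
    A B X Y X' Y' : List ℕ
    σ σ' τ τ' ρ π ξ : Str
    S S' T : List Str

≼-refl : σ ≼ σ
≼-refl {[]}    = []≼
≼-refl {_ ∷ _} = ∷≼ ≼-refl

≼-trans : σ ≼ τ → τ ≼ ρ → σ ≼ ρ
≼-trans []≼    _      = []≼
≼-trans (∷≼ p) (∷≼ q) = ∷≼ (≼-trans p q)

≼⇒length≤ : σ ≼ τ → length σ ≤ length τ
≼⇒length≤ []≼    = z≤n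
≼⇒length≤ (∷≼ p) = s≤s (≼⇒length≤ p)

≼∧length≡⇒≡ : σ ≼ τ → length σ ≡ length τ → σ ≡ τ
≼∧length≡⇒≡ {τ = []}    []≼    _ = refl
≼∧length≡⇒≡ {τ = _ ∷ _} []≼    ()
≼∧length≡⇒≡ (∷≼ p) e = cong (_ ∷_) (≼∧length≡⇒≡ p (suc-injective e))

≼-common : σ ≼ ρ → τ ≼ ρ → length σ ≤ length τ → σ ≼ τ
≼-common []≼    _      _       = []≼
≼-common (∷≼ p) (∷≼ q) (s≤s l) = ∷≼ (≼-common p q l)

Comparable : Str → Str → Set
Comparable σ τ = σ ≼ τ ⊎ τ ≼ σ

prefixes-comparable : σ ≼ ρ → τ ≼ ρ → Comparable σ τ
prefixes-comparable {σ} {τ = τ} p q with ≤-total (length σ) (length τ)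
... | inj₁ l = inj₁ (≼-common p q l)
... | inj₂ l = inj₂ (≼-common q p l)

comparable⇒≼ : Comparable σ τ → length σ ≤ length τ → σ ≼ τ
comparable⇒≼ (inj₁ p) _ = p
comparable⇒≼ (inj₂ p) l = subst (_≼ _) (≼∧length≡⇒≡ p (≤-antisym (≼⇒length≤ p) l)) ≼-refl

comparable⇒≡ : Comparable σ τ → length σ ≡ length τ → σ ≡ τ
comparable⇒≡ c e = ≼∧length≡⇒≡ (comparable⇒≼ c (≤-reflexive e)) e

prefixes-≡ : σ ≼ ρ → τ ≼ ρ → length σ ≡ length τ → σ ≡ τ
prefixes-≡ p q = comparable⇒≡ (prefixes-comparable p q)

comparable-↓ : Comparable ρ σ → τ ≼ σ → Comparable ρ τ
comparable-↓ (inj₁ q) p = prefixes-comparable q p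
comparable-↓ (inj₂ q) p = inj₂ (≼-trans p q)

incompatible-↑ : Incompatible σ τ → σ ≼ σ' → τ ≼ τ' → Incompatible σ' τ'
incompatible-↑ (σ⋠τ , τ⋠σ) p q =
  (λ r → [ σ⋠τ , τ⋠σ ] (prefixes-comparable (≼-trans p r) q)) ,
  (λ r → [ σ⋠τ , τ⋠σ ] (prefixes-comparable p (≼-trans q r)))

_≼?_ : (σ τ : Str) → Dec (σ ≼ τ)
[]      ≼? _       = yes []≼
(_ ∷ _) ≼? []      = no λ ()
(a ∷ σ) ≼? (b ∷ τ) with a Bool.≟ b | σ ≼? τ
... | yes refl | yes p  = yes (∷≼ p)
... | yes refl | no σ⋠τ = no λ { (∷≼ p) → σ⋠τ p }
... | no a≢b   | _      = no λ { (∷≼ _) → a≢b refl }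

comparable? : (σ τ : Str) → Dec (Comparable σ τ)
comparable? σ τ = (σ ≼? τ) ⊎-dec (τ ≼? σ)

comparable-through : ρ ≼ τ → Comparable τ ξ → Comparable ρ ξ
comparable-through ρ≼τ (inj₁ τ≼ξ) = inj₁ (≼-trans ρ≼τ τ≼ξ)
comparable-through ρ≼τ (inj₂ ξ≼τ) = prefixes-comparable ρ≼τ ξ≼τ

∈⇒≤maxL : ∀ {X} → x ∈ X → x ≤ maxL X
∈⇒≤maxL {X = y ∷ X} (here refl) = m≤m⊔n y (maxL X)
∈⇒≤maxL {X = y ∷ X} (there m)   = ≤-trans (∈⇒≤maxL m) (m≤n⊔m y (maxL X))

maxL-lub : ∀ X → (∀ {x} → x ∈ X → x ≤ y) → maxL X ≤ y
maxL-lub []      _ = z≤n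
maxL-lub (x ∷ X) f = ⊔-lub (f (here refl)) (maxL-lub X (f ∘′ there))

maxL-++ : ∀ A B → maxL (A ++ B) ≡ maxL A ⊔ maxL B
maxL-++ []      B = refl
maxL-++ (a ∷ A) B = trans (cong (a ⊔_) (maxL-++ A B)) (sym (⊔-assoc a (maxL A) (maxL B)))

maxL-⊆ : ∀ {X} Y → Y ⊆ₗ X → maxL Y ≤ maxL X
maxL-⊆ Y sub = maxL-lub Y (λ m → ∈⇒≤maxL (sub m))

maxL∈ : ∀ {X} → NonEmpty X → maxL X ∈ X
maxL∈ {x ∷ []}    _ = here (⊔-identityʳ x)
maxL∈ {x ∷ y ∷ X} _ =
  [ here , (λ e → there (subst (_∈ y ∷ X) (sym e) (maxL∈ {y ∷ X} tt))) ]′ (⊔-sel x (maxL (y ∷ X)))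

minL∈ : ∀ {X} → NonEmpty X → minL X ∈ X
minL∈ {_ ∷ _} _ = here refl

minL≤ : ∀ {X} → StrictInc X → x ∈ X → minL X ≤ x
minL≤ {X = y ∷ X}     _       (here refl) = ≤-refl
minL≤ {X = y ∷ z ∷ X} (l , s) (there m)   = ≤-trans (<⇒≤ l) (minL≤ s m)

minL-⊆ : ∀ {X Y} → StrictInc X → NonEmpty Y → Y ⊆ₗ X → minL X ≤ minL Y
minL-⊆ sX neY sub = minL≤ sX (sub (minL∈ neY))

minL≤maxL : ∀ {X} → NonEmpty X → minL X ≤ maxL X
minL≤maxL ne = ∈⇒≤maxL (minL∈ ne)

minL-++ : ∀ A B → NonEmpty A → minL (A ++ B) ≡ minL A
minL-++ (_ ∷ _) _ _ = refl

NonEmpty-++ : ∀ A B → NonEmpty A → NonEmpty (A ++ B)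
NonEmpty-++ (_ ∷ _) _ _ = tt

∈⇒NonEmpty : ∀ {X} → x ∈ X → NonEmpty X
∈⇒NonEmpty {X = _ ∷ _} _ = tt

lastL : List ℕ → ℕ
lastL []          = 0
lastL (x ∷ [])    = x
lastL (_ ∷ y ∷ X) = lastL (y ∷ X)

lastL≡maxL : ∀ X → StrictInc X → lastL X ≡ maxL X
lastL≡maxL []          _       = refl
lastL≡maxL (x ∷ [])    _       = sym (⊔-identityʳ x)
lastL≡maxL (x ∷ y ∷ X) (l , s) = trans (lastL≡maxL (y ∷ X) s)
  (sym (m≤n⇒m⊔n≡n (≤-trans (<⇒≤ l) (∈⇒≤maxL {X = y ∷ X} (here refl)))))

StrictInc-++ : ∀ A B → StrictInc A → StrictInc B → (∀ {a b} → a ∈ A → b ∈ B → a < b) →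
  StrictInc (A ++ B)
StrictInc-++ []          B       _       sB _ = sB
StrictInc-++ (a ∷ [])    []      _       _  _ = tt
StrictInc-++ (a ∷ [])    (b ∷ B) _       sB f = f (here refl) (here refl) , sB
StrictInc-++ (a ∷ a' ∷ A) B      (l , sA) sB f = l , StrictInc-++ (a' ∷ A) B sA sB (f ∘′ there)

Stack-head : ∀ {X Xs} → Stack (X ∷ Xs) → StrictInc X × NonEmpty X
Stack-head {Xs = []}    h       = h
Stack-head {Xs = _ ∷ _} (h , _) = h

Stack-tail : ∀ {X Xs} → Stack (X ∷ Xs) → Stack Xs
Stack-tail {Xs = []}    _           = tt
Stack-tail {Xs = _ ∷ _} (_ , _ , s) = s

mutual
  Stack⇒StrictInc : ∀ Xs → Stack Xs → StrictInc (concat Xs)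
  Stack⇒StrictInc []       _  = tt
  Stack⇒StrictInc (X ∷ Xs) st = StrictInc-++ X (concat Xs) (proj₁ (Stack-head st))
    (Stack⇒StrictInc Xs (Stack-tail st)) (Stack-separated X Xs st)

  Stack-separated : ∀ X Xs → Stack (X ∷ Xs) → ∀ {a b} → a ∈ X → b ∈ concat Xs → a < b
  Stack-separated X (Y ∷ Xs) (_ , l , st) {b = b} a∈X b∈Xs =
    ≤-<-trans (∈⇒≤maxL a∈X) (<-≤-trans l (subst (_≤ b)
      (minL-++ Y (concat Xs) (proj₂ (Stack-head st))) (minL≤ (Stack⇒StrictInc (Y ∷ Xs) st) b∈Xs)))

Stack-maxL<minL : ∀ {X Xs} → Stack (X ∷ Xs) → NonEmpty (concat Xs) → maxL X < minL (concat Xs)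
Stack-maxL<minL {X} {Xs} st ne = Stack-separated X Xs st (maxL∈ (proj₂ (Stack-head st))) (minL∈ ne)

Stack-++ : ∀ A B → Stack A → Stack B → (∀ {a b} → a ∈ concat A → b ∈ concat B → a < b) →
  Stack (A ++ B)
Stack-++ []           B       _              sB _ = sB
Stack-++ (P ∷ [])     []      sA             _  _ = sA
Stack-++ (P ∷ [])     (Q ∷ B) sA@(_ , neP)   sB f =
  sA , f (∈-++⁺ˡ (maxL∈ neP)) (∈-++⁺ˡ (minL∈ (proj₂ (Stack-head sB)))) , sB
Stack-++ (P ∷ P' ∷ A) B       (h , l , sA)   sB f =
  h , l , Stack-++ (P' ∷ A) B sA sB (f ∘′ ∈-++⁺ʳ P)

maxL-++-right : ∀ A B → maxL A ≤ maxL B → maxL (A ++ B) ≡ maxL B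
maxL-++-right A B le = trans (maxL-++ A B) (m≤n⇒m⊔n≡n le)

separated : StrictInc B → maxL A < minL B → a ∈ A → b ∈ B → a < b
separated sB A<B a∈ b∈ = ≤-<-trans (∈⇒≤maxL a∈) (<-≤-trans A<B (minL≤ sB b∈))

DownwardClosed : (Str → Set) → Set
DownwardClosed P = ∀ {σ τ} → P σ → τ ≼ σ → P τ

filter-isTree : ∀ {P : Str → Set} (P? : Decidable P) → DownwardClosed P →
  IsTree T → IsTree (filter P? T)
filter-isTree {T = T} P? closed tree σ∈ τ≼σ with ∈-filter⁻ P? {xs = T} σ∈
... | σ∈T , Pσ = ∈-filter⁺ P? (tree σ∈T τ≼σ) (closed Pσ τ≼σ)

leaf-above : σ ∈ S → Σ Str λ μ → IsLeaf S μ × σ ≼ μ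
leaf-above {σ} {S} σ∈S = μ , (proj₁ μ-ext , maximal) , proj₂ μ-ext
  where
  above = filter (σ ≼?_) S
  μ = argmax length σ above
  μ-ext : μ ∈ S × σ ≼ μ
  μ-ext = argmax-all length (σ∈S , ≼-refl) (tabulate (∈-filter⁻ (σ ≼?_) {xs = S}))
  maximal : ∀ τ → τ ∈ S → μ ≼ τ → τ ≡ μ
  maximal τ τ∈S μ≼τ = sym (≼∧length≡⇒≡ μ≼τ (≤-antisym (≼⇒length≤ μ≼τ)
    (v≤f[argmax]⁺ σ above (inj₂ (lose τ∈above ≤-refl)))))
    where τ∈above = ∈-filter⁺ (σ ≼?_) τ∈S (≼-trans (proj₂ μ-ext) μ≼τ)

OnLevel : List Str → ℕ → Str → Set
OnLevel T n σ = σ ∈ T × length σ ≡ n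

onLevel? : ∀ T n → Decidable (OnLevel T n)
onLevel? T n σ = (σ ∈? T) ×-dec (length σ ≟ n)

choice : ∀ {D A : Set} {P : D → Set} {Q : D → A → Set} → Decidable P → A →
  (∀ d → P d → Σ A (Q d)) → Σ (D → A) λ f → ∀ d → P d → Q d (f d)
choice {D} {A} {P} {Q} P? a g = f , spec
  where
  f : D → A
  f d with P? d
  ... | yes p = proj₁ (g d p)
  ... | no _  = a
  spec : ∀ d → P d → Q d (f d)
  spec d p with P? d
  ... | yes p' = proj₂ (g d p')
  ... | no ¬p  = ⊥-elim (¬p p)

ExtendsTo : List Str → ℕ → Str → Set
ExtendsTo S M σ = Σ Str λ τ → τ ∈ S × length τ ≡ M × σ ≼ τ

ExtendsTo-↓ : DownwardClosed (ExtendsTo S M)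
ExtendsTo-↓ (τ , τ∈ , l , σ≼τ) p = τ , τ∈ , l , ≼-trans p σ≼τ

extendsTo? : ∀ S M σ → Dec (ExtendsTo S M σ)
extendsTo? S M σ = map′ from to (any? (λ τ → (length τ ≟ M) ×-dec (σ ≼? τ)) S)
  where
  from : Any (λ τ → length τ ≡ M × σ ≼ τ) S → ExtendsTo S M σ
  from e = let τ , τ∈ , l , p = find e in τ , τ∈ , l , p
  to : ExtendsTo S M σ → Any (λ τ → length τ ≡ M × σ ≼ τ) S
  to (τ , τ∈ , l , p) = lose τ∈ (l , p)

Branching : List Str → ℕ → ℕ → Set
Branching S x y = ∀ σ → σ ∈ S → length σ ≡ x → TwoExt S σ y

QuasiStrong⇒NonEmpty : ∀ Y → QuasiStrong Y S → NonEmpty Y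
QuasiStrong⇒NonEmpty (_ ∷ _) _ = tt

QuasiStrong-++ : ∀ A B → NonEmpty A → NonEmpty B →
  QuasiStrong A S → QuasiStrong B S → Branching S (lastL A) (minL B) → QuasiStrong (A ++ B) S
QuasiStrong-++ (a ∷ [])     (b ∷ B) _ _ qA            qB br = qA , br , qB
QuasiStrong-++ (a ∷ a' ∷ A) B       _ neB (r , br' , qA) qB br =
  r , br' , QuasiStrong-++ (a' ∷ A) B tt neB qA qB br

QuasiStrong-++⁻ : ∀ A B → NonEmpty A → NonEmpty B → QuasiStrong (A ++ B) S →
  QuasiStrong A S × QuasiStrong B S × Branching S (lastL A) (minL B)
QuasiStrong-++⁻ (a ∷ [])     (b ∷ B) _ _   (r , br , qB) = r , qB , br
QuasiStrong-++⁻ (a ∷ a' ∷ A) B       _ neB (r , br , q)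
  with QuasiStrong-++⁻ (a' ∷ A) B tt neB q
... | qA , qB , br' = (r , br , qA) , qB , br'

QuasiStrong-root : ∀ X → QuasiStrong X S → LevelNonEmpty S (minL X)
QuasiStrong-root (x ∷ [])    r       = r
QuasiStrong-root (x ∷ y ∷ X) (r , _) = r

QuasiStrong-extendsTo : ∀ X → QuasiStrong X S → σ ∈ S → length σ ∈ X → ExtendsTo S (lastL X) σ
QuasiStrong-extendsTo (x ∷ [])    _            σ∈S (here l) = _ , σ∈S , l , ≼-refl
QuasiStrong-extendsTo (x ∷ y ∷ X) (_ , br , q) σ∈S (here l) =
  let τ , _ , (τ∈S , lτ , σ≼τ) , _ = br _ σ∈S l
      μ , μ∈S , lμ , τ≼μ = QuasiStrong-extendsTo (y ∷ X) q τ∈S (here lτ)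
  in μ , μ∈S , lμ , ≼-trans σ≼τ τ≼μ
QuasiStrong-extendsTo (x ∷ y ∷ X) (_ , _ , q) σ∈S (there l) = QuasiStrong-extendsTo (y ∷ X) q σ∈S l

QuasiStrong-extendsToMax : ∀ X → StrictInc X → QuasiStrong X S → σ ∈ S → length σ ∈ X →
  ExtendsTo S (maxL X) σ
QuasiStrong-extendsToMax X sX q σ∈S l with QuasiStrong-extendsTo X q σ∈S l
... | μ , μ∈S , lμ , σ≼μ = μ , μ∈S , trans lμ (lastL≡maxL X sX) , σ≼μ

TwoExt-transfer : TwoExt S σ y →
  (∀ {τ} → τ ∈ S → length τ ≡ y → σ ≼ τ → τ ∈ S') →
  (∀ {τ} → τ ∈ S' → length τ ≡ y → σ ≼ τ → τ ∈ S) → TwoExt S' σ y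
TwoExt-transfer (τ₁ , τ₂ , (τ₁∈ , l₁ , p₁) , (τ₂∈ , l₂ , p₂) , inc , only) forth back =
  τ₁ , τ₂ , (forth τ₁∈ l₁ p₁ , l₁ , p₁) , (forth τ₂∈ l₂ p₂ , l₂ , p₂) , inc ,
  λ τ τ∈ lτ σ≼τ → only τ (back τ∈ lτ σ≼τ) lτ σ≼τ

QuasiStrong-transfer : ∀ A → QuasiStrong A S → LevelNonEmpty S' (minL A) →
  (∀ {τ} → τ ∈ S' → length τ ∈ A → τ ∈ S) →
  (∀ {σ τ} → σ ∈ S' → τ ∈ S → length σ ∈ A → length τ ∈ A → σ ≼ τ → τ ∈ S') →
  QuasiStrong A S'
QuasiStrong-transfer (a ∷ [])     _            root _    _     = root
QuasiStrong-transfer (a ∷ a' ∷ A) (_ , br , q) root back forth =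
  root , br' , QuasiStrong-transfer (a' ∷ A) q root' (λ τ∈ l → back τ∈ (there l))
    (λ σ∈ τ∈ lσ lτ → forth σ∈ τ∈ (there lσ) (there lτ))
  where
  br' : Branching _ a a'
  br' σ σ∈ lσ = TwoExt-transfer (br σ (back σ∈ (here lσ)) lσ)
    (λ τ∈ lτ → forth σ∈ τ∈ (here lσ) (there (here lτ))) (λ τ∈ lτ _ → back τ∈ (there (here lτ)))
  root' : LevelNonEmpty _ a'
  root' with br' _ (proj₁ (proj₂ root)) (proj₂ (proj₂ root))
  ... | τ , _ , (τ∈ , lτ , _) , _ = τ , τ∈ , lτ

QuasiStrong-filter : ∀ A {P : Str → Set} (P? : Decidable P) → QuasiStrong A S →
  (∀ {σ τ} → σ ∈ S → τ ∈ S → length σ ∈ A → length τ ∈ A → σ ≼ τ → P σ → P τ) →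
  σ ∈ S → length σ ≡ minL A → P σ → QuasiStrong A (filter P? S)
QuasiStrong-filter {S = S} A P? q up σ∈ lσ Pσ =
  QuasiStrong-transfer A q (_ , ∈-filter⁺ P? σ∈ Pσ , lσ) (λ τ∈ _ → proj₁ (∈-filter⁻ P? {xs = S} τ∈))
    λ σ∈' τ∈ lσ' lτ σ≼τ → let (σ∈S , Pσ') = ∈-filter⁻ P? {xs = S} σ∈' in
      ∈-filter⁺ P? τ∈ (up σ∈S τ∈ lσ' lτ σ≼τ Pσ')

QuasiStrong-⊆ : ∀ A → QuasiStrong A S → (∀ {τ} → τ ∈ S → τ ∈ S') →
  (∀ {τ} → τ ∈ S' → length τ ∈ A → τ ∈ S) → QuasiStrong A S'
QuasiStrong-⊆ A q sub back with QuasiStrong-root A q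
... | ν , ν∈ , lν = QuasiStrong-transfer A q (ν , sub ν∈ , lν) back (λ _ τ∈ _ _ _ → sub τ∈)

TwoPoints : List ℕ → Set
TwoPoints Y = Σ ℕ λ a → Σ ℕ λ b → a ∈ Y × b ∈ Y × a < b

twoIncompatibleTops : ∀ Y → QuasiStrong Y S → TwoPoints Y →
  Σ Str λ μ₁ → Σ Str λ μ₂ → (μ₁ ∈ S × length μ₁ ≡ lastL Y) × (μ₂ ∈ S × length μ₂ ≡ lastL Y) ×
    Incompatible μ₁ μ₂
twoIncompatibleTops (y ∷ []) _ (_ , _ , here refl , here refl , a<a) = ⊥-elim (<-irrefl refl a<a)
twoIncompatibleTops (y ∷ y' ∷ Y) ((σ , σ∈ , lσ) , br , q) _ with br σ σ∈ lσ
... | τ₁ , τ₂ , (τ₁∈ , l₁ , _) , (τ₂∈ , l₂ , _) , inc , _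
  with QuasiStrong-extendsTo (y' ∷ Y) q τ₁∈ (here l₁)
     | QuasiStrong-extendsTo (y' ∷ Y) q τ₂∈ (here l₂)
... | μ₁ , μ₁∈ , m₁ , p₁ | μ₂ , μ₂∈ , m₂ , p₂ =
  μ₁ , μ₂ , (μ₁∈ , m₁) , (μ₂∈ , m₂) , incompatible-↑ inc p₁ p₂

QuasiStrong-⋃ : ∀ W {I : Set} (R : I → List Str) (r : I → Str) {m : ℕ} →
  (∀ i → QuasiStrong W (R i)) → (∀ i {ξ} → ξ ∈ R i → length ξ ∈ W → r i ≼ ξ) →
  (∀ i → length (r i) ≡ m) → (∀ i j → r i ≡ r j → R i ≡ R j) →
  (∀ {ξ} → ξ ∈ S → Σ I λ i → ξ ∈ R i) → (∀ i {ξ} → ξ ∈ R i → ξ ∈ S) → I → QuasiStrong W S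
QuasiStrong-⋃ [] R r q _ _ _ _ _ i₀ = q i₀
QuasiStrong-⋃ (w ∷ []) R r q _ _ _ _ into i₀ =
  let ν , ν∈ , lν = q i₀ in ν , into i₀ ν∈ , lν
QuasiStrong-⋃ (w ∷ w' ∷ W) R r q rooted lr coh cover into i₀ =
  let ν , ν∈ , lν = proj₁ (q i₀) in
  (ν , into i₀ ν∈ , lν) , br ,
  QuasiStrong-⋃ (w' ∷ W) R r (λ i → proj₂ (proj₂ (q i))) (λ i ξ∈ l → rooted i ξ∈ (there l))
    lr coh cover into i₀
  where
  br : Branching _ w w'
  br σ σ∈ lσ with cover σ∈
  ... | i , σ∈R = TwoExt-transfer (proj₁ (proj₂ (q i)) σ σ∈R lσ) (λ τ∈ _ _ → into i τ∈) back
    where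
    back : ∀ {τ} → τ ∈ _ → length τ ≡ w' → σ ≼ τ → τ ∈ R i
    back τ∈ lτ σ≼τ with cover τ∈
    ... | j , τ∈R =
      let rσ = rooted i σ∈R (here lσ)
          same-root = prefixes-≡ (≼-trans rσ σ≼τ) (rooted j τ∈R (there (here lτ)))
                        (trans (lr i) (sym (lr j)))
      in subst (_ ∈_) (sym (coh i j same-root)) τ∈R

module _ {k : ℕ} where

  ColouredExt : List Str → ℕ → (Str → Fin k) → Fin k → Str → Set
  ColouredExt T M C c σ = Σ Str λ τ → τ ∈ T × length τ ≡ M × σ ≼ τ × C τ ≡ c

  -- Grafting needs all three: the cones keep solutions above distinct nodes apart,
  -- the single root gives exactly two successors at each fork, and every node of the trunk
  -- continues to a top node carrying a fork.
  record RootedSolution (T : List Str) (Y : List ℕ) (M : ℕ) (ρ : Str) (C : Str → Fin k)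
                        (c : Fin k) (S : List Str) : Set where
    field
      isTree         : IsTree S
      ⊆T             : ∀ {σ} → σ ∈ S → σ ∈ T
      quasiStrong    : QuasiStrong Y S
      comparableRoot : ∀ {σ} → σ ∈ S → Comparable ρ σ
      uniqueRoot     : ∀ {σ σ'} → σ ∈ S → σ' ∈ S → length σ ≡ minL Y → length σ' ≡ minL Y → σ ≡ σ'
      extendsToTop   : ∀ {σ} → σ ∈ S → ExtendsTo S (maxL Y) σ
      topColoured    : ∀ {σ} → σ ∈ S → length σ ≡ maxL Y → ColouredExt T M C c σ

  Rooted : List Str → List ℕ → ℕ → Str → (Str → Fin k) → Set
  Rooted T Y M ρ C = Σ (Fin k) λ c → Σ (List Str) (RootedSolution T Y M ρ C c)

  prune : ∀ {T S Y M ρ} {C : Str → Fin k} {c} → StrictInc Y → IsTree S → QuasiStrong Y S →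
    (∀ {σ} → σ ∈ S → σ ∈ T) → (∀ {σ} → σ ∈ S → Comparable ρ σ) →
    (∀ σ → IsLeaf S σ → ColouredExt T M C c σ) → Σ (List Str) (RootedSolution T Y M ρ C c)
  prune {T} {S} {Y} {M} {ρ} {C} {c} sY treeS qS S⊆T rootedS leafColoured = pruned , record
    { isTree         = filter-isTree keep? (λ (cmp , ext) p → comparable-↓ cmp p , ExtendsTo-↓ ext p)
                         treeS
    ; ⊆T             = S⊆T ∘′ kept⇒∈
    ; quasiStrong    = QuasiStrong-filter Y keep? qS keep-↑ ν∈ lν
                         (inj₁ ≼-refl , QuasiStrong-extendsToMax Y sY qS ν∈ (level∈Y lν))
    ; comparableRoot = rootedS ∘′ kept⇒∈
    ; uniqueRoot     = λ σ∈ σ'∈ l l' → trans (≡ν σ∈ l) (sym (≡ν σ'∈ l'))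
    ; extendsToTop   = extendsToTop
    ; topColoured    = topColoured
    }
    where
    ν  = proj₁ (QuasiStrong-root Y qS)
    ν∈ = proj₁ (proj₂ (QuasiStrong-root Y qS))
    lν = proj₂ (proj₂ (QuasiStrong-root Y qS))
    Keep : Str → Set
    Keep σ = Comparable ν σ × ExtendsTo S (maxL Y) σ
    keep? : Decidable Keep
    keep? σ = comparable? ν σ ×-dec extendsTo? S (maxL Y) σ
    pruned = filter keep? S
    kept⇒∈ : σ ∈ pruned → σ ∈ S
    kept⇒∈ σ∈ = proj₁ (∈-filter⁻ keep? {xs = S} σ∈)
    level∈Y : ∀ {n} → n ≡ minL Y → n ∈ Y
    level∈Y l = subst (_∈ Y) (sym l) (minL∈ (QuasiStrong⇒NonEmpty Y qS))
    ν≼ : Comparable ν σ → length σ ∈ Y → ν ≼ σ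
    ν≼ cmp l = comparable⇒≼ cmp (subst (_≤ _) (sym lν) (minL≤ sY l))
    keep-↑ : ∀ {σ τ} → σ ∈ S → τ ∈ S → length σ ∈ Y → length τ ∈ Y → σ ≼ τ → Keep σ → Keep τ
    keep-↑ _ τ∈ lσ lτ σ≼τ (cmp , _) =
      inj₁ (≼-trans (ν≼ cmp lσ) σ≼τ) , QuasiStrong-extendsToMax Y sY qS τ∈ lτ
    ≡ν : σ ∈ pruned → length σ ≡ minL Y → σ ≡ ν
    ≡ν σ∈ l = sym (comparable⇒≡ (proj₁ (proj₂ (∈-filter⁻ keep? {xs = S} σ∈))) (trans lν (sym l)))
    top∈ : τ ∈ S → length τ ≡ maxL Y → ν ≼ τ → τ ∈ pruned
    top∈ τ∈ l ν≼τ = ∈-filter⁺ keep? τ∈ (inj₁ ν≼τ , _ , τ∈ , l , ≼-refl)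
    extendsToTop : σ ∈ pruned → ExtendsTo pruned (maxL Y) σ
    extendsToTop σ∈ with ∈-filter⁻ keep? {xs = S} σ∈
    ... | _ , inj₁ ν≼σ , (τ , τ∈ , l , σ≼τ) = τ , top∈ τ∈ l (≼-trans ν≼σ σ≼τ) , l , σ≼τ
    ... | _ , inj₂ σ≼ν , _ =
      let τ , τ∈ , l , ν≼τ = QuasiStrong-extendsToMax Y sY qS ν∈ (level∈Y lν)
      in τ , top∈ τ∈ l ν≼τ , l , ≼-trans σ≼ν ν≼τ
    topColoured : σ ∈ pruned → length σ ≡ maxL Y → ColouredExt T M C c σ
    topColoured σ∈ _ =
      let μ , μ-leaf , σ≼μ = leaf-above (kept⇒∈ σ∈)
          τ , τ∈ , l , μ≼τ , Cτ = leafColoured μ μ-leaf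
      in τ , τ∈ , l , ≼-trans σ≼μ μ≼τ , Cτ

  Arrow : List ℕ → List ℕ → Set
  Arrow X Y = ∀ T → IsTree T → QuasiStrong X T → ∀ (C : Str → Fin k) →
    Σ (Fin k) λ c → Σ (List Str) λ S →
      IsTree S × (∀ {σ} → σ ∈ S → σ ∈ T) × QuasiStrong Y S ×
      (∀ σ → IsLeaf S σ → ColouredExt T (maxL X) C c σ)

  RootedArrow : List ℕ → List ℕ → Set
  RootedArrow X Y = ∀ T → IsTree T → QuasiStrong X T →
    ∀ ρ → ρ ∈ T → length ρ ≡ minL X → ∀ (C : Str → Fin k) → Rooted T Y (maxL X) ρ C

  rootedArrow⇒arrow : RootedArrow X Y → Arrow X Y
  rootedArrow⇒arrow {X} {Y} arrow T treeT qT C =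
    let ρ , ρ∈ , lρ = QuasiStrong-root X qT
        c , S , sol = arrow T treeT qT ρ ρ∈ lρ C
        open RootedSolution sol
        leafColoured : ∀ σ → IsLeaf S σ → ColouredExt T (maxL X) C c σ
        leafColoured σ (σ∈ , maximal) =
          let τ , τ∈ , l , σ≼τ = extendsToTop σ∈
          in topColoured σ∈ (subst (λ μ → length μ ≡ maxL Y) (maximal τ τ∈ σ≼τ) l)
    in c , S , isTree , ⊆T , quasiStrong , leafColoured

  cone : Str → List Str → List Str
  cone ρ = filter (comparable? ρ)

  cone-quasiStrong : ∀ X → StrictInc X → QuasiStrong X T → ρ ∈ T → length ρ ≡ minL X →
    QuasiStrong X (cone ρ T)
  cone-quasiStrong {ρ = ρ} X sX qT ρ∈ lρ = QuasiStrong-filter X (comparable? ρ) qT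
    (λ _ _ lσ _ σ≼τ cmp →
       inj₁ (≼-trans (comparable⇒≼ cmp (subst (_≤ _) (sym lρ) (minL≤ sX lσ))) σ≼τ))
    ρ∈ lρ (inj₁ ≼-refl)

  arrow⇒rootedArrow : StrictInc X → StrictInc Y → Arrow X Y → RootedArrow X Y
  arrow⇒rootedArrow {X} sX sY arrow T treeT qT ρ ρ∈ lρ C with
    arrow (cone ρ T) (filter-isTree (comparable? ρ) comparable-↓ treeT)
          (cone-quasiStrong X sX qT ρ∈ lρ) C
  ... | c , S , treeS , S⊆cone , qS , leafColoured =
    c , prune sY treeS qS (∈cone⇒∈ ∘′ S⊆cone) (∈cone⇒comparable ∘′ S⊆cone) colouredInT
    where
    ∈cone⇒∈ : σ ∈ cone ρ T → σ ∈ T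
    ∈cone⇒∈ σ∈ = proj₁ (∈-filter⁻ (comparable? ρ) {xs = T} σ∈)
    ∈cone⇒comparable : σ ∈ cone ρ T → Comparable ρ σ
    ∈cone⇒comparable σ∈ = proj₂ (∈-filter⁻ (comparable? ρ) {xs = T} σ∈)
    colouredInT : ∀ σ → IsLeaf S σ → ColouredExt T (maxL X) C c σ
    colouredInT σ leaf = let τ , τ∈ , rest = leafColoured σ leaf in τ , ∈cone⇒∈ τ∈ , rest

  -- Grafting

  record Fork (T : List Str) (Y : List ℕ) (M m : ℕ) (C : Str → Fin k) (c : Fin k) (σ : Str)
              (root : Bool → Str) (tree : Bool → List Str) : Set where
    field
      σ≼root       : ∀ j → σ ≼ root j
      rootLevel    : ∀ j → length (root j) ≡ m
      solution     : ∀ j → RootedSolution T Y M (root j) C c (tree j)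
      incompatible : Incompatible (root true) (root false)

  module Graft {T Y₀ Y M₀ M ρ m} {C₀ C : Str → Fin k} {c₀ c S₀}
    (sol₀ : RootedSolution T Y₀ M₀ ρ C₀ c₀ S₀) (sY₀ : StrictInc Y₀) (sY : StrictInc Y)
    (ρ≤Y₀ : length ρ ≤ maxL Y₀) (Y₀<m : maxL Y₀ < m) (m≤Y : m ≤ minL Y)
    (root : Str → Bool → Str) (tree : Str → Bool → List Str)
    (fork : ∀ {σ} → σ ∈ S₀ → length σ ≡ maxL Y₀ → Fork T Y M m C c σ (root σ) (tree σ)) where

    module S₀ = RootedSolution sol₀

    tops : List Str
    tops = filter (λ σ → length σ ≟ maxL Y₀) S₀

    top⁻ : σ ∈ tops → σ ∈ S₀ × length σ ≡ maxL Y₀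
    top⁻ = ∈-filter⁻ (λ σ → length σ ≟ maxL Y₀) {xs = S₀}

    forkAt : σ ∈ tops → Fork T Y M m C c σ (root σ) (tree σ)
    forkAt σ∈ = let σ∈S₀ , lσ = top⁻ σ∈ in fork σ∈S₀ lσ

    module Branch {σ} (σ∈ : σ ∈ tops) (j : Bool) = RootedSolution (Fork.solution (forkAt σ∈) j)

    branches : Str → List Str
    branches σ = tree σ true ++ tree σ false

    Rs : List Str
    Rs = concatMap branches tops

    S₀∪Rs : List Str
    S₀∪Rs = S₀ ++ Rs

    Rs⁺ : σ ∈ tops → ∀ j → ξ ∈ tree σ j → ξ ∈ Rs
    Rs⁺ σ∈ true  ξ∈ = ∈-concatMap⁺ branches (lose σ∈ (∈-++⁺ˡ ξ∈))
    Rs⁺ σ∈ false ξ∈ = ∈-concatMap⁺ branches (lose σ∈ (∈-++⁺ʳ (tree _ true) ξ∈))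

    Index : Set
    Index = Σ Str (_∈ tops) × Bool

    rootAt : Index → Str
    rootAt ((σ , _) , j) = root σ j

    treeAt : Index → List Str
    treeAt ((σ , _) , j) = tree σ j

    Rs⁻ : ξ ∈ Rs → Σ Index λ i → ξ ∈ treeAt i
    Rs⁻ ξ∈ with find (∈-concatMap⁻ branches {xs = tops} ξ∈)
    ... | σ , σ∈ , ξ∈b with ∈-++⁻ (tree σ true) ξ∈b
    ... | inj₁ ξ∈t = ((σ , σ∈) , true) , ξ∈t
    ... | inj₂ ξ∈f = ((σ , σ∈) , false) , ξ∈f

    data Node (ξ : Str) : Set where
      trunk  : ξ ∈ S₀ → Node ξ
      branch : ∀ {σ} → σ ∈ tops → ∀ j → ξ ∈ tree σ j → Node ξ

    view : ξ ∈ S₀∪Rs → Node ξ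
    view ξ∈ with ∈-++⁻ S₀ ξ∈
    ... | inj₁ ξ∈S₀ = trunk ξ∈S₀
    ... | inj₂ ξ∈Rs with Rs⁻ ξ∈Rs
    ... | ((_ , σ∈) , j) , ξ∈t = branch σ∈ j ξ∈t

    unview : Node ξ → ξ ∈ S₀∪Rs
    unview (trunk ξ∈)       = ∈-++⁺ˡ ξ∈
    unview (branch σ∈ j ξ∈) = ∈-++⁺ʳ S₀ (Rs⁺ σ∈ j ξ∈)

    S₀-short : ξ ∈ S₀ → length ξ ≤ maxL Y₀
    S₀-short ξ∈ = let _ , _ , l , ξ≼τ = S₀.extendsToTop ξ∈ in subst (_ ≤_) l (≼⇒length≤ ξ≼τ)

    root≼branch : (σ∈ : σ ∈ tops) → ∀ j → ξ ∈ tree σ j → m ≤ length ξ → root σ j ≼ ξ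
    root≼branch σ∈ j ξ∈ l = comparable⇒≼ (Branch.comparableRoot σ∈ j ξ∈)
      (subst (_≤ _) (sym (Fork.rootLevel (forkAt σ∈) j)) l)

    short⇒S₀ : ξ ∈ S₀∪Rs → length ξ ≤ maxL Y₀ → ξ ∈ S₀
    short⇒S₀ ξ∈ l with view ξ∈
    ... | trunk ξ∈S₀ = ξ∈S₀
    ... | branch σ∈ j ξ∈t with Branch.comparableRoot σ∈ j ξ∈t
    ... | inj₁ r≼ξ = ⊥-elim (<-irrefl refl (<-≤-trans Y₀<m (≤-trans
          (subst (_≤ _) (Fork.rootLevel (forkAt σ∈) j) (≼⇒length≤ r≼ξ)) l)))
    ... | inj₂ ξ≼r = S₀.isTree (proj₁ (top⁻ σ∈))
          (≼-common ξ≼r (Fork.σ≼root (forkAt σ∈) j) (subst (_ ≤_) (sym (proj₂ (top⁻ σ∈))) l))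

    S₀-below-m : ξ ∈ S₀ → m ≤ length ξ → ⊥
    S₀-below-m ξ∈ l = <-irrefl refl (<-≤-trans Y₀<m (≤-trans l (S₀-short ξ∈)))

    neY₀ : NonEmpty Y₀
    neY₀ = QuasiStrong⇒NonEmpty Y₀ S₀.quasiStrong

    aTop : Σ Str (_∈ tops)
    aTop = let ν , ν∈ , _ = QuasiStrong-root Y₀ S₀.quasiStrong
               σ , σ∈ , l , _ = S₀.extendsToTop ν∈
           in σ , ∈-filter⁺ (λ σ → length σ ≟ maxL Y₀) σ∈ l

    neY : NonEmpty Y
    neY = QuasiStrong⇒NonEmpty Y (Branch.quasiStrong (proj₂ aTop) true)

    m≤maxY : m ≤ maxL Y
    m≤maxY = ≤-trans m≤Y (minL≤maxL neY)

    maxL-Y₀++Y : maxL (Y₀ ++ Y) ≡ maxL Y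
    maxL-Y₀++Y = maxL-++-right Y₀ Y (≤-trans (<⇒≤ Y₀<m) m≤maxY)

    minL-Y₀++Y : minL (Y₀ ++ Y) ≡ minL Y₀
    minL-Y₀++Y = minL-++ Y₀ Y neY₀

    coherent : ∀ i i' → rootAt i ≡ rootAt i' → treeAt i ≡ treeAt i'
    coherent ((σ , σ∈) , j) ((σ' , σ'∈) , j') e
      with prefixes-≡ (Fork.σ≼root (forkAt σ∈) j)
                      (subst (σ' ≼_) (sym e) (Fork.σ≼root (forkAt σ'∈) j'))
                      (trans (proj₂ (top⁻ σ∈)) (sym (proj₂ (top⁻ σ'∈))))
    ... | refl = same-root j j' e
      where
      incompatible = Fork.incompatible (forkAt σ∈)
      same-root : ∀ j j' → root σ j ≡ root σ j' → tree σ j ≡ tree σ j'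
      same-root true  true  _ = refl
      same-root false false _ = refl
      same-root true  false e = ⊥-elim (proj₁ incompatible (subst (root σ true ≼_) e ≼-refl))
      same-root false true  e = ⊥-elim (proj₁ incompatible (subst (root σ true ≼_) (sym e) ≼-refl))

    quasiStrong-Rs : QuasiStrong Y Rs
    quasiStrong-Rs = QuasiStrong-⋃ Y treeAt rootAt (λ ((_ , σ∈) , j) → Branch.quasiStrong σ∈ j)
      (λ ((_ , σ∈) , j) ξ∈ l → root≼branch σ∈ j ξ∈ (≤-trans m≤Y (minL≤ sY l)))
      (λ ((_ , σ∈) , j) → Fork.rootLevel (forkAt σ∈) j)
      coherent Rs⁻ (λ ((_ , σ∈) , j) → Rs⁺ σ∈ j) (aTop , true)

    quasiStrong-Y₀ : QuasiStrong Y₀ S₀∪Rs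
    quasiStrong-Y₀ = QuasiStrong-⊆ Y₀ S₀.quasiStrong ∈-++⁺ˡ (λ τ∈ l → short⇒S₀ τ∈ (∈⇒≤maxL l))

    quasiStrong-Y : QuasiStrong Y S₀∪Rs
    quasiStrong-Y = QuasiStrong-⊆ Y quasiStrong-Rs (∈-++⁺ʳ S₀) back
      where
      back : τ ∈ S₀∪Rs → length τ ∈ Y → τ ∈ Rs
      back τ∈ l with ∈-++⁻ S₀ τ∈
      ... | inj₁ τ∈S₀ = ⊥-elim (S₀-below-m τ∈S₀ (≤-trans m≤Y (minL≤ sY l)))
      ... | inj₂ τ∈Rs = τ∈Rs

    junction : Branching S₀∪Rs (lastL Y₀) (minL Y)
    junction σ σ∈ l = ν true , ν false , ext true , ext false ,
      incompatible-↑ (Fork.incompatible F) (root≼ν true) (root≼ν false) , only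
      where
      lσ = trans l (lastL≡maxL Y₀ sY₀)
      σ∈tops = ∈-filter⁺ (λ σ → length σ ≟ maxL Y₀) (short⇒S₀ σ∈ (≤-reflexive lσ)) lσ
      F = forkAt σ∈tops
      ν : Bool → Str
      ν j = proj₁ (QuasiStrong-root Y (Branch.quasiStrong σ∈tops j))
      ν∈ : ∀ j → ν j ∈ tree σ j
      ν∈ j = proj₁ (proj₂ (QuasiStrong-root Y (Branch.quasiStrong σ∈tops j)))
      lν : ∀ j → length (ν j) ≡ minL Y
      lν j = proj₂ (proj₂ (QuasiStrong-root Y (Branch.quasiStrong σ∈tops j)))
      root≼ν : ∀ j → root σ j ≼ ν j
      root≼ν j = root≼branch σ∈tops j (ν∈ j) (subst (m ≤_) (sym (lν j)) m≤Y)
      ext : ∀ j → ν j ∈ S₀∪Rs × length (ν j) ≡ minL Y × σ ≼ ν j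
      ext j = unview (branch σ∈tops j (ν∈ j)) , lν j , ≼-trans (Fork.σ≼root F j) (root≼ν j)
      only : ∀ τ → τ ∈ S₀∪Rs → length τ ≡ minL Y → σ ≼ τ → τ ≡ ν true ⊎ τ ≡ ν false
      only τ τ∈ lτ σ≼τ with view τ∈
      ... | trunk τ∈S₀ = ⊥-elim (S₀-below-m τ∈S₀ (subst (m ≤_) (sym lτ) m≤Y))
      ... | branch {σ'} σ'∈ j τ∈t
        with prefixes-≡ (≼-trans (Fork.σ≼root (forkAt σ'∈) j)
                                 (root≼branch σ'∈ j τ∈t (subst (m ≤_) (sym lτ) m≤Y)))
                        σ≼τ (trans (proj₂ (top⁻ σ'∈)) (sym lσ))
      ... | refl = pick j (Branch.uniqueRoot σ∈tops j τ∈t (ν∈ j) lτ (lν j))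
        where
        pick : ∀ j → τ ≡ ν j → τ ≡ ν true ⊎ τ ≡ ν false
        pick true  = inj₁
        pick false = inj₂

    grafted : RootedSolution T (Y₀ ++ Y) M ρ C c S₀∪Rs
    grafted = record
      { isTree         = isTree
      ; ⊆T             = ⊆T
      ; quasiStrong    = QuasiStrong-++ Y₀ Y neY₀ neY quasiStrong-Y₀ quasiStrong-Y junction
      ; comparableRoot = comparableRoot
      ; uniqueRoot     = λ σ∈ σ'∈ l l' →
                           S₀.uniqueRoot (short⇒S₀ σ∈ (atRoot l)) (short⇒S₀ σ'∈ (atRoot l'))
                                         (trans l minL-Y₀++Y) (trans l' minL-Y₀++Y)
      ; extendsToTop   = extendsToTop
      ; topColoured    = topColoured
      }
      where
      atRoot : ∀ {n} → n ≡ minL (Y₀ ++ Y) → n ≤ maxL Y₀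
      atRoot l = subst (_≤ _) (sym (trans l minL-Y₀++Y)) (minL≤maxL neY₀)
      isTree : IsTree S₀∪Rs
      isTree ξ∈ p with view ξ∈
      ... | trunk ξ∈S₀       = unview (trunk (S₀.isTree ξ∈S₀ p))
      ... | branch σ∈ j ξ∈t = unview (branch σ∈ j (Branch.isTree σ∈ j ξ∈t p))
      ⊆T : ξ ∈ S₀∪Rs → ξ ∈ T
      ⊆T ξ∈ with view ξ∈
      ... | trunk ξ∈S₀       = S₀.⊆T ξ∈S₀
      ... | branch σ∈ j ξ∈t = Branch.⊆T σ∈ j ξ∈t
      comparableRoot : ξ ∈ S₀∪Rs → Comparable ρ ξ
      comparableRoot ξ∈ with view ξ∈
      ... | trunk ξ∈S₀       = S₀.comparableRoot ξ∈S₀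
      ... | branch σ∈ j ξ∈t =
        let σ∈S₀ , lσ = top⁻ σ∈
            ρ≼σ = comparable⇒≼ (S₀.comparableRoot σ∈S₀) (subst (_ ≤_) (sym lσ) ρ≤Y₀)
        in comparable-through (≼-trans ρ≼σ (Fork.σ≼root (forkAt σ∈) j))
                              (Branch.comparableRoot σ∈ j ξ∈t)
      extendsToTop : ξ ∈ S₀∪Rs → ExtendsTo S₀∪Rs (maxL (Y₀ ++ Y)) ξ
      extendsToTop ξ∈ with view ξ∈
      ... | branch σ∈ j ξ∈t =
        let τ , τ∈ , l , ξ≼τ = Branch.extendsToTop σ∈ j ξ∈t
        in τ , unview (branch σ∈ j τ∈) , trans l (sym maxL-Y₀++Y) , ξ≼τ
      ... | trunk ξ∈S₀ =
        let σ , σ∈S₀ , lσ , ξ≼σ = S₀.extendsToTop ξ∈S₀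
            σ∈ = ∈-filter⁺ (λ σ → length σ ≟ maxL Y₀) σ∈S₀ lσ
            ν , ν∈ , _ = QuasiStrong-root Y (Branch.quasiStrong σ∈ true)
            τ , τ∈ , l , _ = Branch.extendsToTop σ∈ true ν∈
            root≼τ = root≼branch σ∈ true τ∈ (subst (m ≤_) (sym l) m≤maxY)
        in τ , unview (branch σ∈ true τ∈) , trans l (sym maxL-Y₀++Y) ,
           ≼-trans ξ≼σ (≼-trans (Fork.σ≼root (forkAt σ∈) true) root≼τ)
      topColoured : ξ ∈ S₀∪Rs → length ξ ≡ maxL (Y₀ ++ Y) → ColouredExt T M C c ξ
      topColoured ξ∈ l with view ξ∈
      ... | trunk ξ∈S₀ =
        ⊥-elim (S₀-below-m ξ∈S₀ (subst (m ≤_) (sym (trans l maxL-Y₀++Y)) m≤maxY))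
      ... | branch σ∈ j ξ∈t = Branch.topColoured σ∈ j ξ∈t (trans l maxL-Y₀++Y)

  -- Gluing segments

  record SolvedAbove (T : List Str) (X Y : List ℕ) (C : Str → Fin k) (π : Str) (c : Fin k) :
                     Set where
    field
      root      : Str
      π≼root    : π ≼ root
      rootLevel : length root ≡ minL X
      tree      : List Str
      solution  : RootedSolution T Y (maxL X) root C c tree

  SolvedAbove-↓ : ∀ {C c} → σ ≼ π → SolvedAbove T X Y C π c → SolvedAbove T X Y C σ c
  SolvedAbove-↓ σ≼π s = record
    { root = root ; π≼root = ≼-trans σ≼π π≼root ; rootLevel = rootLevel
    ; tree = tree ; solution = solution }
    where open SolvedAbove s

  -- Colour each node on level max A by the colour of a rooted solution for (X, Y) above it;
  -- the segment preceding (X, Y) is then solved for this colouring.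
  lookahead : IsTree T → Branching T (lastL A) (minL X) → StrictInc A → QuasiStrong X T →
    RootedArrow X Y → (C : Str → Fin k) →
    Σ (Str → Fin k) λ C' → ∀ π → OnLevel T (maxL A) π → SolvedAbove T X Y C π (C' π)
  lookahead {T} {A} {X} {Y} treeT br sA qX arrow C = choice (onLevel? T (maxL A)) (C []) solve
    where
    solve : ∀ π → OnLevel T (maxL A) π → Σ (Fin k) (SolvedAbove T X Y C π)
    solve π (π∈ , lπ) =
      let ρ , _ , (ρ∈ , lρ , π≼ρ) , _ = br π π∈ (trans lπ (sym (lastL≡maxL A sA)))
          c , S , sol = arrow T treeT qX ρ ρ∈ lρ C
      in c , record { root = ρ ; π≼root = π≼ρ ; rootLevel = lρ ; tree = S ; solution = sol }

  solvedAboveTops : ∀ {C C' c ρ} → (∀ π → OnLevel T M π → SolvedAbove T X Y C π (C' π)) →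
    RootedSolution T Y' M ρ C' c S → σ ∈ S → length σ ≡ maxL Y' → SolvedAbove T X Y C σ c
  solvedAboveTops {T = T} {X = X} {Y = Y} {C = C} spec sol σ∈ l =
    let τ , τ∈ , lτ , σ≼τ , C'τ = RootedSolution.topColoured sol σ∈ l
    in SolvedAbove-↓ σ≼τ (subst (SolvedAbove T X Y C τ) C'τ (spec τ (τ∈ , lτ)))

  forkAboveIncompatibleTops : ∀ {T S X Y Y' M C C' c ρ} →
    StrictInc Y' → TwoPoints Y' → length ρ ≤ maxL Y' →
    (∀ π → OnLevel T M π → SolvedAbove T X Y C π (C' π)) → RootedSolution T Y' M ρ C' c S →
    Σ ((Bool → Str) × (Bool → List Str)) λ (r , R) → Fork T Y (maxL X) (minL X) C c ρ r R
  forkAboveIncompatibleTops {T} {S} {X} {Y} {Y'} {M} {C} {C'} {c} {ρ} sY' two lρ spec sol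
    with twoIncompatibleTops Y' (RootedSolution.quasiStrong sol) two
  ... | μ₁ , μ₂ , μ₁-top , μ₂-top , μ₁#μ₂ = (root , tree) , record
    { σ≼root       = λ j → ≼-trans (ρ≼μ j) (SolvedAbove.π≼root (above j))
    ; rootLevel    = λ j → SolvedAbove.rootLevel (above j)
    ; solution     = λ j → SolvedAbove.solution (above j)
    ; incompatible = incompatible-↑ μ₁#μ₂ (SolvedAbove.π≼root (above true))
                                          (SolvedAbove.π≼root (above false))
    }
    where
    μ : Bool → Str
    μ true  = μ₁
    μ false = μ₂
    μ-top : ∀ j → μ j ∈ S × length (μ j) ≡ lastL Y'
    μ-top true  = μ₁-top
    μ-top false = μ₂-top
    l-top : ∀ j → length (μ j) ≡ maxL Y'
    l-top j = trans (proj₂ (μ-top j)) (lastL≡maxL Y' sY')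
    ρ≼μ : ∀ j → ρ ≼ μ j
    ρ≼μ j = comparable⇒≼ (RootedSolution.comparableRoot sol (proj₁ (μ-top j)))
      (subst (_ ≤_) (sym (l-top j)) lρ)
    above : ∀ j → SolvedAbove T X Y C (μ j) c
    above j = solvedAboveTops spec sol (proj₁ (μ-top j)) (l-top j)
    root : Bool → Str
    root j = SolvedAbove.root (above j)
    tree : Bool → List Str
    tree j = SolvedAbove.tree (above j)

  Fork-↓ : ∀ {Y M m C c r R} → σ ≼ π → Fork T Y M m C c π r R → Fork T Y M m C c σ r R
  Fork-↓ σ≼π f = record
    { σ≼root = λ j → ≼-trans σ≼π (σ≼root j) ; rootLevel = rootLevel ; solution = solution
    ; incompatible = incompatible }
    where open Fork f

  record Segment (X Y : List ℕ) : Set where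
    field
      strictX     : StrictInc X
      strictY     : StrictInc Y
      nonEmptyY   : NonEmpty Y
      Y⊆X         : Y ⊆ₗ X
      rootedArrow : RootedArrow X Y

    nonEmptyX : NonEmpty X
    nonEmptyX = ∈⇒NonEmpty (Y⊆X (minL∈ nonEmptyY))

    minX≤minY : minL X ≤ minL Y
    minX≤minY = minL-⊆ strictX nonEmptyY Y⊆X

    minX≤maxY : minL X ≤ maxL Y
    minX≤maxY = ≤-trans minX≤minY (minL≤maxL nonEmptyY)

    maxY≤maxX : maxL Y ≤ maxL X
    maxY≤maxX = maxL-⊆ Y Y⊆X

  open Segment

  module _ {X₀ Y₀ X₁ Y₁ X₂ Y₂} (s₀ : Segment X₀ Y₀) (s₁ : Segment X₁ Y₁) (s₂ : Segment X₂ Y₂)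
           (X₀<X₁ : maxL X₀ < minL X₁) (X₁<X₂ : maxL X₁ < minL X₂) where

    private
      X₁≤X₂ : maxL X₁ ≤ maxL X₂
      X₁≤X₂ = ≤-trans (<⇒≤ X₁<X₂) (minL≤maxL (nonEmptyX s₂))

      maxL-X₁₂ : maxL (X₁ ++ X₂) ≡ maxL X₂
      maxL-X₁₂ = maxL-++-right X₁ X₂ X₁≤X₂

      minL-X₁₂ : minL (X₁ ++ X₂) ≡ minL X₁
      minL-X₁₂ = minL-++ X₁ X₂ (nonEmptyX s₁)

      minL-X₀₁₂ : minL (X₀ ++ X₁ ++ X₂) ≡ minL X₀
      minL-X₀₁₂ = minL-++ X₀ (X₁ ++ X₂) (nonEmptyX s₀)

      maxL-X₀₁₂ : maxL (X₀ ++ X₁ ++ X₂) ≡ maxL X₂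
      maxL-X₀₁₂ = trans (maxL-++-right X₀ (X₁ ++ X₂) (subst (maxL X₀ ≤_) (sym maxL-X₁₂)
        (≤-trans (<⇒≤ X₀<X₁) (≤-trans (minL≤maxL (nonEmptyX s₁)) X₁≤X₂)))) maxL-X₁₂

      Y₀<X₂ : maxL Y₀ < minL X₂
      Y₀<X₂ = ≤-<-trans (maxY≤maxX s₀)
                (<-≤-trans X₀<X₁ (≤-trans (minL≤maxL (nonEmptyX s₁)) (<⇒≤ X₁<X₂)))

    glue-rootedArrow : TwoPoints Y₁ → RootedArrow (X₀ ++ X₁ ++ X₂) (Y₀ ++ Y₂)
    glue-rootedArrow two₁ T treeT qT ρ ρ∈ lρ C
      with QuasiStrong-++⁻ X₀ (X₁ ++ X₂) (nonEmptyX s₀) (NonEmpty-++ X₁ X₂ (nonEmptyX s₁)) qT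
    ... | q₀ , q₁₂ , br₀ with QuasiStrong-++⁻ X₁ X₂ (nonEmptyX s₁) (nonEmptyX s₂) q₁₂
    ... | q₁ , q₂ , br₁ with lookahead treeT br₁ (strictX s₁) q₂ (rootedArrow s₂) C
    ... | C₁ , C₁-spec
      with lookahead treeT (subst (Branching T (lastL X₀)) minL-X₁₂ br₀) (strictX s₀) q₁
                     (rootedArrow s₁) C₁
    ... | C₀ , C₀-spec with rootedArrow s₀ T treeT q₀ ρ ρ∈ (trans lρ minL-X₀₁₂) C₀
    ... | c , S₀ , sol₀ =
      c , G.S₀∪Rs ,
      subst (λ M → RootedSolution T (Y₀ ++ Y₂) M ρ C c G.S₀∪Rs) (sym maxL-X₀₁₂) G.grafted
      where
      ρ≤Y₀ : length ρ ≤ maxL Y₀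
      ρ≤Y₀ = subst (_≤ maxL Y₀) (sym (trans lρ minL-X₀₁₂)) (minX≤maxY s₀)
      Forked : Str → (Bool → Str) × (Bool → List Str) → Set
      Forked σ (r , R) = Fork T Y₂ (maxL X₂) (minL X₂) C c σ r R
      fork : ∀ σ → OnLevel S₀ (maxL Y₀) σ → Σ ((Bool → Str) × (Bool → List Str)) (Forked σ)
      fork σ (σ∈ , lσ) =
        let τ , τ∈ , lτ , σ≼τ , C₀τ = RootedSolution.topColoured sol₀ σ∈ lσ
            above = SolvedAbove-↓ σ≼τ (subst (SolvedAbove T X₁ Y₁ C₁ τ) C₀τ (C₀-spec τ (τ∈ , lτ)))
            open SolvedAbove above
            rR , f = forkAboveIncompatibleTops (strictY s₁) two₁
                       (subst (_≤ maxL Y₁) (sym rootLevel) (minX≤maxY s₁)) C₁-spec solution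
        in rR , Fork-↓ π≼root f
      forks = choice (onLevel? S₀ (maxL Y₀)) ((λ _ → []) , (λ _ → [])) fork
      root : Str → Bool → Str
      root σ = proj₁ (proj₁ forks σ)
      tree : Str → Bool → List Str
      tree σ = proj₂ (proj₁ forks σ)
      module G = Graft sol₀ (strictY s₀) (strictY s₂) ρ≤Y₀ Y₀<X₂ (minX≤minY s₂) root tree
                   (λ σ∈ lσ → proj₂ forks _ (σ∈ , lσ))

    glue : TwoPoints Y₁ → Segment (X₀ ++ X₁ ++ X₂) (Y₀ ++ Y₂)
    glue two₁ = record
      { strictX     = StrictInc-++ X₀ (X₁ ++ X₂) (strictX s₀) strictX₁₂
                        (separated strictX₁₂ (subst (maxL X₀ <_) (sym minL-X₁₂) X₀<X₁))
      ; strictY     = StrictInc-++ Y₀ Y₂ (strictY s₀) (strictY s₂)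
                        (separated (strictY s₂) (<-≤-trans Y₀<X₂ (minX≤minY s₂)))
      ; nonEmptyY   = NonEmpty-++ Y₀ Y₂ (nonEmptyY s₀)
      ; Y⊆X         = Y⊆X₀₁₂
      ; rootedArrow = glue-rootedArrow two₁
      }
      where
      strictX₁₂ = StrictInc-++ X₁ X₂ (strictX s₁) (strictX s₂) (separated (strictX s₂) X₁<X₂)
      Y⊆X₀₁₂ : (Y₀ ++ Y₂) ⊆ₗ (X₀ ++ X₁ ++ X₂)
      Y⊆X₀₁₂ y∈ with ∈-++⁻ Y₀ y∈
      ... | inj₁ y∈Y₀ = ∈-++⁺ˡ (Y⊆X s₀ y∈Y₀)
      ... | inj₂ y∈Y₂ = ∈-++⁺ʳ X₀ (∈-++⁺ʳ X₁ (Y⊆X s₂ y∈Y₂))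

-- Persistence

Large⇒TwoPoints : ∀ d {P} → 1 ≤ d → Large d P → (∀ {y} → y ∈ P → 1 ≤ y) → TwoPoints P
Large⇒TwoPoints 1             {a ∷ []}    _ (_ , _ , s≤s z≤n) pos with pos (here refl)
... | ()
Large⇒TwoPoints 1             {a ∷ b ∷ _} _ ((a<b , _) , _) _ =
  a , b , here refl , there (here refl) , a<b
Large⇒TwoPoints (suc (suc d)) {a ∷ b ∷ _} _ (_ , a<b , _)     _ =
  a , b , here refl , there (here refl) , a<b

module _ {d n' k : ℕ} where

  Persistent⇒StrictInc : ∀ i {X} → Persistent d n' k i X → StrictInc X
  Persistent⇒StrictInc zero    (Xs , _ , st , refl , _) = Stack⇒StrictInc Xs st
  Persistent⇒StrictInc (suc i) (sX , _)                 = sX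

  Persistent⇒NonEmpty : ∀ i {X} → 1 ≤ n' → Persistent d n' k i X → NonEmpty X
  Persistent⇒NonEmpty zero {X} (s≤s _) (P ∷ Ps , _ , st , refl , _) =
    NonEmpty-++ P (concat Ps) (proj₂ (Stack-head st))
  Persistent⇒NonEmpty (suc i) hn (_ , Y , Y⊆X , pY , _) =
    ∈⇒NonEmpty (Y⊆X (minL∈ (Persistent⇒NonEmpty i hn pY)))

  Persistent⇒TwoPoints : ∀ i {Y} → 1 ≤ d → 1 ≤ n' → Persistent d n' k i Y →
    (∀ {y} → y ∈ Y → 1 ≤ y) → TwoPoints Y
  Persistent⇒TwoPoints zero    hd (s≤s _) (P ∷ _ , _ , _ , refl , largeP ∷ _) pos =
    let a , b , a∈ , b∈ , a<b = Large⇒TwoPoints d hd largeP (pos ∘′ ∈-++⁺ˡ)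
    in a , b , ∈-++⁺ˡ a∈ , ∈-++⁺ˡ b∈ , a<b
  Persistent⇒TwoPoints (suc i) hd hn (_ , Y' , Y'⊆Y , pY' , _) pos =
    let a , b , a∈ , b∈ , a<b = Persistent⇒TwoPoints i hd hn pY' (λ y∈ → pos (Y'⊆Y y∈))
    in a , b , Y'⊆Y a∈ , Y'⊆Y b∈ , a<b

  open Segment

  persistent⇒segment : ∀ {i X} → 1 ≤ n' → (p : Persistent d n' k (suc i) X) →
    Segment {k} X (proj₁ (proj₂ p))
  persistent⇒segment {i} hn (sX , Y , Y⊆X , pY , arrow) = record
    { strictX     = sX
    ; strictY     = Persistent⇒StrictInc i pY
    ; nonEmptyY   = Persistent⇒NonEmpty i hn pY
    ; Y⊆X         = Y⊆X
    ; rootedArrow = arrow⇒rootedArrow sX (Persistent⇒StrictInc i pY) arrow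
    }

  odd-suc : ∀ M → suc M + suc M + 1 ≡ 2 + (M + M + 1)
  odd-suc M = cong (λ m → suc (m + 1)) (+-suc M M)

  record GluedStack (i M : ℕ) (Xs : List (List ℕ)) : Set where
    field
      Ys         : List (List ℕ)
      length-Ys  : length Ys ≡ M + 1
      stack-Ys   : Stack Ys
      persistent : All (Persistent d n' k i) Ys
      segment    : Segment {k} (concat Xs) (concat Ys)

  glueStack : ∀ {i} → 1 ≤ d → 1 ≤ n' → ∀ M Xs → length Xs ≡ M + M + 1 → Stack Xs →
    All (Persistent d n' k (suc i)) Xs → GluedStack i M Xs
  glueStack hd hn zero (X ∷ []) _ _ (p@(_ , Y , _ , pY , _) ∷ []) = record
    { Ys         = Y ∷ []
    ; length-Ys  = refl
    ; stack-Ys   = Persistent⇒StrictInc _ pY , Persistent⇒NonEmpty _ hn pY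
    ; persistent = pY ∷ []
    ; segment    = subst₂ Segment (sym (++-identityʳ X)) (sym (++-identityʳ Y))
                     (persistent⇒segment hn p)
    }
  glueStack hd hn (suc M) (_ ∷ []) len _ _ with trans len (odd-suc M)
  ... | ()
  glueStack {i} hd hn (suc M) (X₀ ∷ X₁ ∷ Xs) len st
            (p₀@(_ , Y₀ , _ , pY₀ , _) ∷ p₁@(_ , _ , Y₁⊆X₁ , pY₁ , _) ∷ ps) = record
    { Ys         = Y₀ ∷ Ys
    ; length-Ys  = cong suc length-Ys
    ; stack-Ys   = Stack-++ (Y₀ ∷ []) Ys (strictY s₀ , nonEmptyY s₀) stack-Ys Y₀<Ys
    ; persistent = pY₀ ∷ persistent
    ; segment    = glue s₀ s₁ segment X₀<X₁ X₁<Xs (Persistent⇒TwoPoints i hd hn pY₁ Y₁-positive)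
    }
    where
    open GluedStack (glueStack hd hn M Xs (suc-injective (suc-injective (trans len (odd-suc M))))
                      (Stack-tail (Stack-tail st)) ps)
    s₀ = persistent⇒segment hn p₀
    s₁ = persistent⇒segment hn p₁
    X₀<X₁ : maxL X₀ < minL X₁
    X₀<X₁ = proj₁ (proj₂ st)
    X₁<Xs : maxL X₁ < minL (concat Xs)
    X₁<Xs = Stack-maxL<minL (proj₂ (proj₂ st)) (nonEmptyX segment)
    Y₁-positive : ∀ {y} → y ∈ proj₁ (proj₂ p₁) → 1 ≤ y
    Y₁-positive y∈ = ≤-trans (≤-trans (s≤s z≤n) X₀<X₁) (minL≤ (strictX s₁) (Y₁⊆X₁ y∈))
    Y₀<Ys : ∀ {a b} → a ∈ concat (Y₀ ∷ []) → b ∈ concat Ys → a < b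
    Y₀<Ys a∈ b∈ = Stack-separated X₀ (X₁ ∷ Xs) st (Y⊆X s₀ (subst (_ ∈_) (++-identityʳ Y₀) a∈))
                    (∈-++⁺ʳ X₁ (Y⊆X segment b∈))

LargeN-concat : ∀ d n' Xs → Stack Xs → All (LargeN d n') Xs → LargeN d (length Xs * n') (concat Xs)
LargeN-concat d n' []       _  []                                    = [] , refl , tt , refl , []
LargeN-concat d n' (X ∷ Xs) st ((Ps , lPs , stPs , refl , lgPs) ∷ ls) =
  let Qs , lQs , stQs , eQs , lgQs = LargeN-concat d n' Xs (Stack-tail st) ls
  in Ps ++ Qs ,
     trans (length-++ Ps) (cong₂ _+_ lPs lQs) ,
     Stack-++ Ps Qs stPs stQs
       (λ a∈ b∈ → Stack-separated (concat Ps) Xs st a∈ (subst (_ ∈_) eQs b∈)) ,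
     trans (sym (concat-++ Ps Qs)) (cong (concat Ps ++_) eQs) ,
     All.++⁺ lgPs lgQs

2^[1+i]n∸2^[1+i]≡double : ∀ i n →
  2 ^ suc i * n ∸ 2 ^ suc i ≡ (2 ^ i * n ∸ 2 ^ i) + (2 ^ i * n ∸ 2 ^ i)
2^[1+i]n∸2^[1+i]≡double i n = begin
  2 * 2 ^ i * n ∸ 2 * 2 ^ i     ≡⟨ cong (_∸ 2 * 2 ^ i) (*-assoc 2 (2 ^ i) n) ⟩
  2 * (2 ^ i * n) ∸ 2 * 2 ^ i   ≡⟨ *-distribˡ-∸ 2 (2 ^ i * n) (2 ^ i) ⟨
  2 * (2 ^ i * n ∸ 2 ^ i)       ≡⟨ cong ((2 ^ i * n ∸ 2 ^ i) +_) (+-identityʳ _) ⟩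
  (2 ^ i * n ∸ 2 ^ i) + (2 ^ i * n ∸ 2 ^ i) ∎
  where open ≡-Reasoning

lemma2p10 : ∀ (d n' k n i : ℕ) → 1 ≤ d → 1 ≤ n' → 1 ≤ k → 1 ≤ n →
    ∀ (Xs : List (List ℕ)) → length Xs ≡ 2 ^ i * n ∸ 2 ^ i + 1 →
    Stack Xs → All (Persistent d n' k i) Xs →
    Persistent d (n' * n) k i (concat Xs)
-- hk is not needed: a colouring C supplies the default colour C [] used in lookahead.
lemma2p10 d n' k n zero hd hn' hk hn Xs len st ps =
  subst (λ m → LargeN d m (concat Xs)) (trans (cong (_* n') length≡n) (*-comm n n'))
    (LargeN-concat d n' Xs st ps)
  where
  length≡n : length Xs ≡ n
  length≡n = trans len (trans (cong (λ m → m ∸ 1 + 1) (*-identityˡ n)) (m∸n+n≡m hn))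
lemma2p10 d n' k n (suc i) hd hn' hk hn Xs len st ps =
  strictX segment , concat Ys , Y⊆X segment ,
  lemma2p10 d n' k n i hd hn' hk hn Ys length-Ys stack-Ys persistent ,
  rootedArrow⇒arrow (rootedArrow segment)
  where
  open Segment
  open GluedStack (glueStack hd hn' (2 ^ i * n ∸ 2 ^ i) Xs
                    (trans len (cong (_+ 1) (2^[1+i]n∸2^[1+i]≡double i n))) st ps)
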